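{- Let $\mathfrak{U}$ be a set and let $\mathcal{B}\subseteq\mathcal{P}(\mathfrak{U})\setminus\{\emptyset\}$ be a directed family (not necessarily unpackable) with $\mathfrak{U}\in\mathcal{B}$. Let $X\subseteq\mathfrak{U}$ be constructible and let $\mathcal{S},\mathcal{T}\subseteq\mathcal{B}$ be finite with $\mathrm{Ch}(\mathcal{S})=\mathrm{Ch}(\mathcal{T})=X$. If $(\mathcal{S},\subseteq)$ and $(\mathcal{T},\subseteq)$ are both $\unlhd$-minimal among all finite $\mathcal{R}\subseteq\mathcal{B}$ with $\mathrm{Ch}(\mathcal{R})=X$, then $\mathcal{S}=\mathcal{T}$.
   Context: A family $\mathcal{B}\subseteq\mathcal{P}(\mathfrak{U})\setminus\{\emptyset\}$ is directed if for all $B_0,B_1\in\mathcal{B}$ one has $B_0\subseteq B_1$, $B_1\subseteq B_0$, or $B_0\cap B_1=\emptyset$; its members are balls, and a constructible set is a finite boolean combination of balls. For a finite set $\mathcal{S}$ of balls (a finite forest under $\subseteq$), define $\mathrm{Lev}_n(\mathcal{S})$ inductively as the set of $\subseteq$-maximal elements of $\mathcal{S}\setminus\bigcup_{i<n}\mathrm{Lev}_i(\mathcal{S})$; write $\lambda(B,\mathcal{S})=n$ if $B\in\mathrm{Lev}_n(\mathcal{S})$, $\mathrm{Sub}(B,\mathcal{S})=\{C\in\mathrm{Lev}_{\lambda(B,\mathcal{S})+1}(\mathcal{S}): C\subseteq B\}$, and $\mathrm{Ch}(\mathcal{S})=\bigcup_{n\ge0}\bigcup_{B\in\mathrm{Lev}_{2n}(\mathcal{S})}\big(B\setminus\bigcup\mathrm{Sub}(B,\mathcal{S})\big)$.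 On finite forests define the quasi-order $\mathcal{S}\unlhd\mathcal{T}$ iff one of: (i) $|\mathcal{S}|=|\mathcal{T}|$ and $|\mathrm{Lev}_n(\mathcal{S})|=|\mathrm{Lev}_n(\mathcal{T})|$ for all $n$; (ii) $|\mathcal{S}|<|\mathcal{T}|$; (iii) $|\mathcal{S}|=|\mathcal{T}|$ and for some $n$, $|\mathrm{Lev}_i(\mathcal{S})|=|\mathrm{Lev}_i(\mathcal{T})|$ for all $i<n$ but $|\mathrm{Lev}_n(\mathcal{S})|>|\mathrm{Lev}_n(\mathcal{T})|$. -}

module Defs where

open import Level using (0ℓ)
open import Data.Nat using (ℕ; zero; suc; _+_; _*_; _<_; _>_)
open import Data.List using (List; []; _∷_; length; filter)
open import Data.Empty using (⊥)
open import Data.Unit using (⊤)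
open import Data.Sum using (_⊎_)
open import Data.Product using (_×_; Σ; ∃)
open import Relation.Nullary using (¬_; Dec; yes; no)
open import Relation.Binary.PropositionalEquality using (_≡_)
open import Axiom.ExcludedMiddle using (ExcludedMiddle)

Sub : Set → Set₁
Sub U = U → Set

module _ {U : Set} where

  _⊆_ : Sub U → Sub U → Set
  B ⊆ C = ∀ x → B x → C x

  _≐_ : Sub U → Sub U → Set
  B ≐ C = (B ⊆ C) × (C ⊆ B)

  Disjoint : Sub U → Sub U → Set
  Disjoint B C = ∀ x → B x → C x → ⊥

  AnyL : {A : Set₁} → (A → Set) → List A → Set
  AnyL P [] = ⊥
  AnyL P (a ∷ as) = P a ⊎ AnyL P as

  AllL : {A : Set₁} → (A → Set) → List A → Set
  AllL P [] = ⊤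
  AllL P (a ∷ as) = P a × AllL P as

  _∈ₛ_ : Sub U → List (Sub U) → Set
  B ∈ₛ S = AnyL (λ C → B ≐ C) S

  _≈ₛ_ : List (Sub U) → List (Sub U) → Set
  S ≈ₛ T = AllL (λ B → B ∈ₛ T) S × AllL (λ B → B ∈ₛ S) T

  IsDirected : (Sub U → Set) → Set₁
  IsDirected 𝓑 = (∀ B → 𝓑 B → Σ U B)
               × (∀ B₀ B₁ → 𝓑 B₀ → 𝓑 B₁ → (B₀ ⊆ B₁) ⊎ ((B₁ ⊆ B₀) ⊎ Disjoint B₀ B₁))

  data BComb (𝓑 : Sub U → Set) : Set₁ where
    ball  : (B : Sub U) → 𝓑 B → BComb 𝓑
    empty : BComb 𝓑
    compl : BComb 𝓑 → BComb 𝓑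
    union : BComb 𝓑 → BComb 𝓑 → BComb 𝓑
    inter : BComb 𝓑 → BComb 𝓑 → BComb 𝓑

  ⟦_⟧ : {𝓑 : Sub U → Set} → BComb 𝓑 → Sub U
  ⟦ ball B _ ⟧ x = B x
  ⟦ empty ⟧ x = ⊥
  ⟦ compl t ⟧ x = ¬ (⟦ t ⟧ x)
  ⟦ union s t ⟧ x = ⟦ s ⟧ x ⊎ ⟦ t ⟧ x
  ⟦ inter s t ⟧ x = ⟦ s ⟧ x × ⟦ t ⟧ x

  Constructible : (Sub U → Set) → Sub U → Set₁
  Constructible 𝓑 X = Σ (BComb 𝓑) (λ t → X ≐ ⟦ t ⟧)

  -- The remaining notions are classical; they are defined relative to
  -- an excluded-middle oracle (supplied as a hypothesis of the theorem).
  module Classical (lem : ExcludedMiddle 0ℓ) where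

    -- remove later duplicates (up to ≐): the finite set represented by a list
    dedup : List (Sub U) → List (Sub U)
    dedup [] = []
    dedup (B ∷ S) with lem {B ∈ₛ S}
    ... | yes _ = dedup S
    ... | no  _ = B ∷ dedup S

    card : List (Sub U) → ℕ
    card S = length (dedup S)

    maximals : List (Sub U) → List (Sub U)
    maximals L = filter (λ B → lem {AllL (λ C → B ⊆ C → C ⊆ B) L}) L

    -- remaining n S = S ∖ ⋃_{i<n} Lev_i(S);  Lev n S = maximal elements of it
    remaining : ℕ → List (Sub U) → List (Sub U)
    Lev : ℕ → List (Sub U) → List (Sub U)
    remaining zero S = dedup S
    remaining (suc n) S = filter (λ B → lem {¬ (B ∈ₛ Lev n S)}) (remaining n S)
    Lev n S = maximals (remaining n S)

    -- Ch(S) = ⋃_n ⋃_{B ∈ Lev_{2n}(S)} (B ∖ ⋃ Sub(B,S)),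
    -- where Sub(B,S) = {C ∈ Lev_{2n+1}(S) : C ⊆ B} since λ(B,S) = 2n.
    Ch : List (Sub U) → Sub U
    Ch S x = Σ ℕ λ n → AnyL (λ B → B x × ¬ AnyL (λ C → (C ⊆ B) × C x) (Lev (suc (2 * n)) S)) (Lev (2 * n) S)

    _⊴_ : List (Sub U) → List (Sub U) → Set
    S ⊴ T = ((card S ≡ card T) × (∀ n → length (Lev n S) ≡ length (Lev n T)))
          ⊎ ((card S < card T)
          ⊎ ((card S ≡ card T) × Σ ℕ λ n → (∀ i → i < n → length (Lev i S) ≡ length (Lev i T))
                                          × (length (Lev n S) > length (Lev n T))))

    IsMinimal : (Sub U → Set) → Sub U → List (Sub U) → Set₁
    IsMinimal 𝓑 X S = ∀ (R : List (Sub U)) → AllL 𝓑 R → Ch R ≐ X → R ⊴ S → S ⊴ R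

module Submission where

-- For a duplicate-free forest R of balls, the n-th level consists of the balls with
-- exactly n strictly larger members. The balls of R through a point x form a chain whose smallest
-- member therefore sits at level (number of balls through x) − 1, so x ∈ Ch(R) iff x lies in an
-- odd number of balls of R. Consequently the part of a forest inside a ball b may be exchanged for
-- any family inside b with the same parity at every point, without changing Ch.
-- Suppose S ≠ T are both ⊴-minimal and let c be a ⊆-maximal ball of their symmetric difference,
-- say c ∈ T ∖ S; above c the two forests agree. Exchanging their parts inside c shows that these
-- parts have the same size and, comparing level sizes at the level of c, that the part of S inside
-- c has a single top D ⊊ c. Let e be a maximal ball of S ∪ T with D ⊆ e ⊊ c, and x ∈ c ∖ e. By
-- parity x lies in at least two balls of T inside c that are not inside e, so S has at least two
-- more balls inside e than T. Replacing the part of S inside e by the part of T inside e with e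
-- toggled keeps Ch and shrinks S, contradicting its minimality.

open import Defs
open import Level using (0ℓ)
open import Axiom.ExcludedMiddle using (ExcludedMiddle)
open import Data.Empty using (⊥; ⊥-elim)
open import Data.Unit using (⊤; tt)
open import Data.Sum using (_⊎_; inj₁; inj₂)
open import Data.Product using (_×_; _,_; proj₁; proj₂; Σ; ∃-syntax)
open import Data.Nat using (ℕ; zero; suc; _+_; _*_; _≤_; _<_; _>_; z≤n; s≤s; parity)
open import Data.Nat.Properties
open import Data.Parity.Base using (Parity; 0ℙ; 1ℙ) renaming (_+_ to _+ℙ_)
import Data.Parity.Properties as ℙ
open import Data.List using (List; []; _∷_; length; filter; _++_)
open import Data.List.Properties
  using (length-++; filter-++; filter-all; filter-none; filter-some; filter-accept; filter-reject)
open import Data.List.Relation.Unary.Any using (Any; here; there)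
open import Data.List.Relation.Unary.All using (All; []; _∷_)
import Data.List.Relation.Unary.All as All
import Data.List.Relation.Unary.All.Properties as All
open import Data.List.Relation.Unary.AllPairs using (AllPairs; []; _∷_)
import Data.List.Relation.Unary.AllPairs.Properties as AllPairs
open import Data.List.Membership.Propositional using (_∈_; find; lose)
open import Data.List.Membership.Propositional.Properties using (∈-filter⁺; ∈-filter⁻; ∈-++⁺ˡ; ∈-++⁺ʳ; ∈-++⁻)
open import Relation.Binary.Definitions using (tri<; tri≈; tri>)
open import Relation.Nullary using (¬_; yes; no; contradiction)
open import Relation.Binary.PropositionalEquality
  using (_≡_; _≢_; refl; sym; trans; cong; cong₂; subst; subst₂; module ≡-Reasoning)
open import Function using (_⇔_; mk⇔; Equivalence; _∘_; flip)

parity-odd : ∀ n → parity (suc (2 * n)) ≡ 1ℙ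
parity-odd n = trans (ℙ.+-homo-+ 1 (2 * n)) (cong (1ℙ +ℙ_) (ℙ.*-homo-* 2 n))

parity-1ℙ⇒odd : ∀ m → parity m ≡ 1ℙ → ∃[ n ] m ≡ suc (2 * n)
parity-1ℙ⇒odd (suc zero) _ = 0 , refl
parity-1ℙ⇒odd (suc (suc m)) odd with parity-1ℙ⇒odd m odd
... | n , refl = suc n , cong suc (sym (*-suc 2 n))

parity-0ℙ⇒≥2 : ∀ m → 0 < m → parity m ≡ 0ℙ → 2 ≤ m
parity-0ℙ⇒≥2 (suc (suc m)) _ _ = s≤s (s≤s z≤n)

parity-cancelʳ : ∀ m n k → parity (m + k) ≡ parity (n + k) → parity m ≡ parity n
parity-cancelʳ m n k eq = ℙ.+-cancelʳ-≡ (parity k) _ _ (trans (sym (ℙ.+-homo-+ m k)) (trans eq (ℙ.+-homo-+ n k)))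

parity-≡ : {p q : Parity} → (p ≡ 1ℙ → q ≡ 1ℙ) → (q ≡ 1ℙ → p ≡ 1ℙ) → p ≡ q
parity-≡ {0ℙ} {0ℙ} _ _ = refl
parity-≡ {0ℙ} {1ℙ} _ q⇒p = q⇒p refl
parity-≡ {1ℙ} {0ℙ} p⇒q _ = sym (p⇒q refl)
parity-≡ {1ℙ} {1ℙ} _ _ = refl

≡-⇔ : ∀ {m m′ n : ℕ} → m ≡ m′ → (m ≡ n) ⇔ (m′ ≡ n)
≡-⇔ m≡m′ = mk⇔ (trans (sym m≡m′)) (trans m≡m′)

module Counting (lem : ExcludedMiddle 0ℓ) {A : Set₁} where

  private
    variable
      P Q : A → Set
      x : A
      xs : List A

  -- Opaque, so that `count P xs` stays neutral: P and xs are then inferable from it, and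
  -- conversion checking never unfolds the classical filter.
  opaque
    select : (A → Set) → List A → List A
    select P = filter (λ x → lem {P x})

  count : (A → Set) → List A → ℕ
  count P xs = length (select P xs)

  element : 0 < length xs → ∃[ x ] x ∈ xs
  element {x ∷ _} _ = x , here refl

  remove : ∀ xs → x ∈ xs → List A
  remove (_ ∷ xs) (here refl) = xs
  remove (y ∷ xs) (there x∈) = y ∷ remove xs x∈

  ∈-remove : (x∈ : x ∈ xs) → ∀ {y} → y ∈ xs → y ≡ x ⊎ y ∈ remove xs x∈
  ∈-remove (here refl) (here refl) = inj₁ refl
  ∈-remove (here refl) (there y∈) = inj₂ y∈
  ∈-remove (there x∈) (here refl) = inj₂ (here refl)
  ∈-remove (there x∈) (there y∈) with ∈-remove x∈ y∈
  ... | inj₁ y≡x = inj₁ y≡x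
  ... | inj₂ y∈′ = inj₂ (there y∈′)

  opaque
    unfolding select

    select-filter : ∀ xs → select P xs ≡ filter (λ x → lem {P x}) xs
    select-filter _ = refl

    ∈-select⁺ : x ∈ xs → P x → x ∈ select P xs
    ∈-select⁺ = ∈-filter⁺ _

    ∈-select⁻ : ∀ xs → x ∈ select P xs → x ∈ xs × P x
    ∈-select⁻ xs = ∈-filter⁻ _ {xs = xs}

    AllPairs-select : ∀ {ℓ} {_~_ : A → A → Set ℓ} → AllPairs _~_ xs → AllPairs _~_ (select P xs)
    AllPairs-select = AllPairs.filter⁺ _

    select-cong : ∀ xs → (∀ {x} → x ∈ xs → P x ⇔ Q x) → select P xs ≡ select Q xs
    select-cong [] P⇔Q = refl
    select-cong {P} {Q} (x ∷ xs) P⇔Q with lem {P x} | lem {Q x}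
    ... | yes _  | yes _  = cong (x ∷_) (select-cong xs (P⇔Q ∘ there))
    ... | yes px | no ¬qx = contradiction (Equivalence.to (P⇔Q (here refl)) px) ¬qx
    ... | no ¬px | yes qx = contradiction (Equivalence.from (P⇔Q (here refl)) qx) ¬px
    ... | no _   | no _   = select-cong xs (P⇔Q ∘ there)

    select-select : ∀ xs → select P (select Q xs) ≡ select (λ x → Q x × P x) xs
    select-select [] = refl
    select-select {P} {Q} (x ∷ xs) with lem {Q x} | lem {Q x × P x}
    ... | no ¬qx | yes qpx = contradiction (proj₁ qpx) ¬qx
    ... | no _   | no _    = select-select xs
    ... | yes qx | qpx? with lem {P x} | qpx?
    ...   | yes _  | yes _    = cong (x ∷_) (select-select xs)
    ...   | yes px | no ¬qpx  = contradiction (qx , px) ¬qpx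
    ...   | no ¬px | yes qpx  = contradiction (proj₂ qpx) ¬px
    ...   | no _   | no _     = select-select xs

    count-++ : ∀ xs ys → count P (xs ++ ys) ≡ count P xs + count P ys
    count-++ xs ys = trans (cong length (filter-++ _ xs ys)) (length-++ (select _ xs))

    count-split : ∀ Q xs → count P xs ≡ count P (select Q xs) + count P (select (¬_ ∘ Q) xs)
    count-split Q [] = refl
    count-split {P} Q (x ∷ xs) with lem {Q x} | lem {¬ Q x}
    ... | yes qx | yes ¬qx = contradiction qx ¬qx
    ... | no ¬qx | no ¬¬qx = contradiction ¬qx ¬¬qx
    ... | yes _  | no _  with lem {P x}
    ...   | yes _ = cong suc (count-split Q xs)
    ...   | no _  = count-split Q xs
    count-split {P} Q (x ∷ xs) | no _ | yes _ with lem {P x}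
    ...   | yes _ = trans (cong suc (count-split Q xs)) (sym (+-suc _ _))
    ...   | no _  = count-split Q xs

    count-mono : ∀ xs → (∀ {x} → x ∈ xs → P x → Q x) → count P xs ≤ count Q xs
    count-mono [] P⇒Q = z≤n
    count-mono {P} {Q} (x ∷ xs) P⇒Q with lem {P x} | lem {Q x}
    ... | yes _  | yes _  = s≤s (count-mono xs (P⇒Q ∘ there))
    ... | yes px | no ¬qx = contradiction (P⇒Q (here refl) px) ¬qx
    ... | no _   | yes _  = m≤n⇒m≤1+n (count-mono xs (P⇒Q ∘ there))
    ... | no _   | no _   = count-mono xs (P⇒Q ∘ there)

    count-strict : (∀ {x} → x ∈ xs → P x → Q x) → x ∈ xs → Q x → ¬ P x → count P xs < count Q xs
    count-strict {x ∷ xs} {P} {Q} P⇒Q x∈ qx ¬px with lem {P x} | lem {Q x} | x∈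
    ... | yes px | _      | here refl = contradiction px ¬px
    ... | no _   | no ¬qx | here refl = contradiction qx ¬qx
    ... | no _   | yes _  | here refl = s≤s (count-mono xs (P⇒Q ∘ there))
    ... | yes _  | yes _  | there x∈′ = s≤s (count-strict (P⇒Q ∘ there) x∈′ qx ¬px)
    ... | yes px | no ¬qx | there _   = contradiction (P⇒Q (here refl) px) ¬qx
    ... | no _   | yes _  | there x∈′ = m≤n⇒m≤1+n (count-strict (P⇒Q ∘ there) x∈′ qx ¬px)
    ... | no _   | no _   | there x∈′ = count-strict (P⇒Q ∘ there) x∈′ qx ¬px

    count-⊎ : ∀ xs → (∀ {x} → x ∈ xs → P x → Q x → ⊥) → count (λ x → P x ⊎ Q x) xs ≡ count P xs + count Q xs
    count-⊎ [] disjoint = refl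
    count-⊎ {P} {Q} (x ∷ xs) disjoint with lem {P x ⊎ Q x} | lem {P x} | lem {Q x}
    ... | _            | yes px | yes qx = ⊥-elim (disjoint (here refl) px qx)
    ... | yes _        | yes _  | no _   = cong suc (count-⊎ xs (disjoint ∘ there))
    ... | yes _        | no _   | yes _  = trans (cong suc (count-⊎ xs (disjoint ∘ there))) (sym (+-suc _ _))
    ... | yes (inj₁ px) | no ¬px | no _  = contradiction px ¬px
    ... | yes (inj₂ qx) | no _  | no ¬qx = contradiction qx ¬qx
    ... | no ¬p⊎q      | yes px | no _   = contradiction (inj₁ px) ¬p⊎q
    ... | no ¬p⊎q      | no _   | yes qx = contradiction (inj₂ qx) ¬p⊎q
    ... | no _         | no _   | no _   = count-⊎ xs (disjoint ∘ there)

    count-zero : ∀ xs → (∀ {x} → x ∈ xs → ¬ P x) → count P xs ≡ 0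
    count-zero _ none = cong length (filter-none _ (All.tabulate none))

    select-all : ∀ xs → (∀ {x} → x ∈ xs → P x) → select P xs ≡ xs
    select-all _ all = filter-all _ (All.tabulate all)

    count-pos : x ∈ xs → P x → 0 < count P xs
    count-pos x∈ px = filter-some _ (lose x∈ px)

    count-witness : 0 < count P xs → ∃[ x ] x ∈ xs × P x
    count-witness {P} {xs} pos with select P xs in eq
    ... | y ∷ _ = let y∈ , py = ∈-select⁻ xs (subst (y ∈_) (sym eq) (here refl)) in y , y∈ , py

    count-[] : count P [] ≡ 0
    count-[] = refl

    count-accept : P x → count P (x ∷ xs) ≡ suc (count P xs)
    count-accept {P} {x} {xs} px = cong length (filter-accept (λ x → lem {P x}) {xs = xs} px)

    count-reject : ¬ P x → count P (x ∷ xs) ≡ count P xs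
    count-reject {P} {x} {xs} ¬px = cong length (filter-reject (λ x → lem {P x}) {xs = xs} ¬px)

    count-remove : (x∈ : x ∈ xs) → P x → count P xs ≡ suc (count P (remove xs x∈))
    count-remove {P = P} (here {x = y} refl) py with lem {P y}
    ... | yes _ = refl
    ... | no ¬py = contradiction py ¬py
    count-remove {P = P} (there {x = y} x∈) px with lem {P y}
    ... | yes _ = cong suc (count-remove x∈ px)
    ... | no _ = count-remove x∈ px

  count-cong : ∀ xs → (∀ {x} → x ∈ xs → P x ⇔ Q x) → count P xs ≡ count Q xs
  count-cong xs = cong length ∘ select-cong xs

  count-select : ∀ xs → count P (select Q xs) ≡ count (λ x → Q x × P x) xs
  count-select = cong length ∘ select-select

  count-all : ∀ xs → (∀ {x} → x ∈ xs → P x) → count P xs ≡ length xs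
  count-all xs = cong length ∘ select-all xs

  length-split : ∀ Q xs → length xs ≡ count Q xs + count (¬_ ∘ Q) xs
  length-split Q xs = trans (sym (count-all xs (λ _ → tt))) (trans (count-split Q xs)
    (cong₂ _+_ (count-all (select Q xs) (λ _ → tt)) (count-all (select (¬_ ∘ Q) xs) (λ _ → tt))))

  count-shifted-below : ∀ {i k} (f : A → ℕ) xs → i < k → count (λ x → k + f x ≡ i) xs ≡ 0
  count-shifted-below {k = k} f xs i<k = count-zero xs λ {x} _ eq → <⇒≱ i<k (≤-trans (m≤m+n k (f x)) (≤-reflexive eq))

  count-shifted-base : ∀ {k} (f : A → ℕ) xs → count (λ x → k + f x ≡ k) xs ≡ count (λ x → f x ≡ 0) xs
  count-shifted-base {k} f xs = count-cong xs λ _ →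
    mk⇔ (λ eq → +-cancelˡ-≡ k _ _ (trans eq (sym (+-identityʳ k)))) (λ eq → trans (cong (k +_) eq) (+-identityʳ k))

  count-≥2 : ∀ {x y} → x ∈ xs → y ∈ xs → x ≢ y → P x → P y → 2 ≤ count P xs
  count-≥2 x∈ y∈ x≢y px py with ∈-remove x∈ y∈
  ... | inj₁ y≡x = ⊥-elim (x≢y (sym y≡x))
  ... | inj₂ y∈′ = subst (2 ≤_) (sym (count-remove x∈ px)) (s≤s (count-pos y∈′ py))

  module _ (_⊏_ : A → A → Set) (⊏-trans : ∀ {x y z} → x ⊏ y → y ⊏ z → x ⊏ z) (⊏-irrefl : ∀ {x} → ¬ x ⊏ x) where

    maximal : x ∈ xs → P x → ∃[ m ] m ∈ xs × P m × (∀ {y} → y ∈ xs → P y → ¬ m ⊏ y)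
    maximal {xs = y ∷ ys} {P} y∈ py with lem {0 < count P ys}
    maximal {xs = y ∷ ys} {P} (here refl) py | no none =
      y , here refl , py , λ { (here refl) _ → ⊏-irrefl ; (there z∈) pz _ → none (count-pos z∈ pz) }
    maximal {xs = y ∷ ys} {P} (there z∈) pz | no none = ⊥-elim (none (count-pos z∈ pz))
    ... | yes some with count-witness some
    ... | z , z∈ , pz with maximal z∈ pz
    ...   | m , m∈ , pm , m-max with lem {P y × m ⊏ y}
    ...     | yes (py , m⊏y) = y , here refl , py , λ
                { (here refl) _ → ⊏-irrefl
                ; (there w∈) pw y⊏w → m-max w∈ pw (⊏-trans m⊏y y⊏w) }
    ...     | no ¬py×m⊏y = m , there m∈ , pm , λ
                { (here refl) py m⊏y → ¬py×m⊏y (py , m⊏y)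
                ; (there w∈) → m-max w∈ }

module Subsets {U : Set} where

  private
    variable
      A B C : Sub U
      P : Sub U → Set
      S : List (Sub U)

  ⊆-refl : B ⊆ B
  ⊆-refl _ b = b

  ⊆-trans : A ⊆ B → B ⊆ C → A ⊆ C
  ⊆-trans A⊆B B⊆C x = B⊆C x ∘ A⊆B x

  ≐-refl : B ≐ B
  ≐-refl = ⊆-refl , ⊆-refl

  ≐-sym : A ≐ B → B ≐ A
  ≐-sym (A⊆B , B⊆A) = B⊆A , A⊆B

  ≐-trans : A ≐ B → B ≐ C → A ≐ C
  ≐-trans (A⊆B , B⊆A) (B⊆C , C⊆B) = ⊆-trans A⊆B B⊆C , ⊆-trans C⊆B B⊆A

  _⊊_ : Sub U → Sub U → Set
  A ⊊ B = A ⊆ B × ¬ B ⊆ A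

  ⊊-irrefl : ¬ B ⊊ B
  ⊊-irrefl (_ , B⊈B) = B⊈B ⊆-refl

  ⊆-⊊-trans : A ⊆ B → B ⊊ C → A ⊊ C
  ⊆-⊊-trans A⊆B (B⊆C , C⊈B) = ⊆-trans A⊆B B⊆C , C⊈B ∘ flip ⊆-trans A⊆B

  ⊊-⊆-trans : A ⊊ B → B ⊆ C → A ⊊ C
  ⊊-⊆-trans (A⊆B , B⊈A) B⊆C = ⊆-trans A⊆B B⊆C , B⊈A ∘ ⊆-trans B⊆C

  ⊊-trans : A ⊊ B → B ⊊ C → A ⊊ C
  ⊊-trans A⊊B = ⊊-⊆-trans A⊊B ∘ proj₁

  NoDup : List (Sub U) → Set₁
  NoDup = AllPairs (λ A B → ¬ A ≐ B)

  AllL⇒All : AllL {U} P S → All P S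
  AllL⇒All {S = []} tt = []
  AllL⇒All {S = _ ∷ _} (p , ps) = p ∷ AllL⇒All ps

  All⇒AllL : All P S → AllL {U} P S
  All⇒AllL [] = tt
  All⇒AllL (p ∷ ps) = p , All⇒AllL ps

  AnyL⇒Any : AnyL {U} P S → Any P S
  AnyL⇒Any {S = _ ∷ _} (inj₁ p) = here p
  AnyL⇒Any {S = _ ∷ _} (inj₂ ps) = there (AnyL⇒Any ps)

  Any⇒AnyL : Any P S → AnyL {U} P S
  Any⇒AnyL (here p) = inj₁ p
  Any⇒AnyL (there ps) = inj₂ (Any⇒AnyL ps)

  ∈ₛ-witness : B ∈ₛ S → ∃[ C ] C ∈ S × B ≐ C
  ∈ₛ-witness = find ∘ AnyL⇒Any

  ∈⇒∈ₛ : C ∈ S → B ≐ C → B ∈ₛ S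
  ∈⇒∈ₛ C∈ B≐C = Any⇒AnyL (lose C∈ B≐C)

  ∈ₛ-resp-≐ : A ≐ B → B ∈ₛ S → A ∈ₛ S
  ∈ₛ-resp-≐ A≐B B∈ₛ = let C , C∈ , B≐C = ∈ₛ-witness B∈ₛ in ∈⇒∈ₛ C∈ (≐-trans A≐B B≐C)

module Forest (lem : ExcludedMiddle 0ℓ) {U : Set} (𝓑 : Sub U → Set) (directed : IsDirected 𝓑) where

  open Classical {U} lem
  open Counting lem {Sub U}
  open Subsets {U}

  private
    variable
      A B C : Sub U
      P : Sub U → Set
      x : U
      n : ℕ
      L L′ S : List (Sub U)

  point : 𝓑 B → Σ U B
  point = proj₁ directed _

  comparable : 𝓑 A → 𝓑 B → A x → B x → A ⊆ B ⊎ B ⊆ A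
  comparable {A} {B} {x} a b Ax Bx with proj₂ directed A B a b
  ... | inj₁ A⊆B = inj₁ A⊆B
  ... | inj₂ (inj₁ B⊆A) = inj₂ B⊆A
  ... | inj₂ (inj₂ disjoint) = ⊥-elim (disjoint x Ax Bx)

  ⊆⇒⊊⊎≐ : A ⊆ B → A ⊊ B ⊎ A ≐ B
  ⊆⇒⊊⊎≐ {A} {B} A⊆B with lem {B ⊆ A}
  ... | yes B⊆A = inj₂ (A⊆B , B⊆A)
  ... | no B⊈A = inj₁ (A⊆B , B⊈A)

  ⊊-witness : A ⊊ B → ∃[ x ] B x × ¬ A x
  ⊊-witness {A} {B} (_ , B⊈A) with lem {∃[ x ] B x × ¬ A x}
  ... | yes witness = witness
  ... | no none = ⊥-elim (B⊈A B⊆A)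
    where
    B⊆A : B ⊆ A
    B⊆A x Bx with lem {A x}
    ... | yes Ax = Ax
    ... | no ¬Ax = ⊥-elim (none (x , Bx , ¬Ax))

  maximal⊊ : A ∈ L → P A → ∃[ M ] M ∈ L × P M × (∀ {B} → B ∈ L → P B → ¬ M ⊊ B)
  maximal⊊ = maximal _⊊_ ⊊-trans ⊊-irrefl

  minimal⊊ : A ∈ L → P A → ∃[ M ] M ∈ L × P M × (∀ {B} → B ∈ L → P B → ¬ B ⊊ M)
  minimal⊊ = maximal (flip _⊊_) (λ B⊋C C⊋D → ⊊-trans C⊋D B⊋C) ⊊-irrefl

  dedup-⊆ : ∀ S → B ∈ dedup S → B ∈ S
  dedup-⊆ (A ∷ S) B∈ with lem {A ∈ₛ S}
  ... | yes _ = there (dedup-⊆ S B∈)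
  dedup-⊆ (A ∷ S) (here refl) | no _ = here refl
  dedup-⊆ (A ∷ S) (there B∈) | no _ = there (dedup-⊆ S B∈)

  dedup-∈ₛ : ∀ S → B ∈ S → B ∈ₛ dedup S
  dedup-∈ₛ (A ∷ S) B∈ with lem {A ∈ₛ S}
  dedup-∈ₛ (A ∷ S) (here refl) | yes A∈ₛS =
    let C , C∈ , A≐C = ∈ₛ-witness A∈ₛS in ∈ₛ-resp-≐ A≐C (dedup-∈ₛ S C∈)
  dedup-∈ₛ (A ∷ S) (there B∈) | yes _ = dedup-∈ₛ S B∈
  dedup-∈ₛ (A ∷ S) (here refl) | no _ = inj₁ ≐-refl
  dedup-∈ₛ (A ∷ S) (there B∈) | no _ = inj₂ (dedup-∈ₛ S B∈)

  dedup-NoDup : ∀ S → NoDup (dedup S)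
  dedup-NoDup [] = []
  dedup-NoDup (A ∷ S) with lem {A ∈ₛ S}
  ... | yes _ = dedup-NoDup S
  ... | no A∉S = All.tabulate (λ B∈ A≐B → A∉S (∈⇒∈ₛ (dedup-⊆ S B∈) A≐B)) ∷ dedup-NoDup S

  dedup-of-NoDup : NoDup S → dedup S ≡ S
  dedup-of-NoDup [] = refl
  dedup-of-NoDup {A ∷ S} (A≉ ∷ nd) with lem {A ∈ₛ S}
  ... | yes A∈ₛS = let B , B∈ , A≐B = ∈ₛ-witness A∈ₛS in ⊥-elim (All.lookup A≉ B∈ A≐B)
  ... | no _ = cong (A ∷_) (dedup-of-NoDup nd)

  count-≐-≤1 : NoDup L → count (_≐ C) L ≤ 1
  count-≐-≤1 [] = subst (_≤ 1) (sym count-[]) z≤n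
  count-≐-≤1 {A ∷ L} {C} (A≉ ∷ nd) with lem {A ≐ C}
  ... | yes A≐C = ≤-reflexive (trans (count-accept A≐C)
                    (cong suc (count-zero L λ B∈ B≐C → All.lookup A≉ B∈ (≐-trans A≐C (≐-sym B≐C)))))
  ... | no A≉C = subst (_≤ 1) (sym (count-reject A≉C)) (count-≐-≤1 nd)

  count-≐-≡1 : NoDup L → C ∈ L → count (_≐ C) L ≡ 1
  count-≐-≡1 nd C∈ = ≤-antisym (count-≐-≤1 nd) (count-pos C∈ ≐-refl)

  count-≐-≡0 : ¬ C ∈ₛ L → count (_≐ C) L ≡ 0
  count-≐-≡0 {L = L} C∉ = count-zero L λ A∈ A≐C → C∉ (∈⇒∈ₛ A∈ (≐-sym A≐C))

  count-⊆ : ∀ L → count (C ⊆_) L ≡ count (C ⊊_) L + count (_≐ C) L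
  count-⊆ L = trans (count-cong L λ _ → mk⇔ split join) (count-⊎ L λ _ (_ , A⊈C) (A⊆C , _) → A⊈C A⊆C)
    where
    split : C ⊆ A → C ⊊ A ⊎ A ≐ C
    split C⊆A with ⊆⇒⊊⊎≐ C⊆A
    ... | inj₁ C⊊A = inj₁ C⊊A
    ... | inj₂ C≐A = inj₂ (≐-sym C≐A)
    join : C ⊊ A ⊎ A ≐ C → C ⊆ A
    join (inj₁ C⊊A) = proj₁ C⊊A
    join (inj₂ A≐C) = proj₂ A≐C

  count-mono-∈ₛ : (∀ {A B} → A ≐ B → P A → P B) → NoDup L → (∀ {A} → A ∈ L → P A → A ∈ₛ L′)
                → count P L ≤ count P L′
  count-mono-∈ₛ {P} {L = []} {L′} resp [] embed = subst (_≤ count P L′) (sym count-[]) z≤n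
  count-mono-∈ₛ {P} {A ∷ L} {L′} resp (A≉ ∷ nd) embed with lem {P A}
  ... | no ¬pA = subst (_≤ count P L′) (sym (count-reject ¬pA)) (count-mono-∈ₛ resp nd (embed ∘ there))
  ... | yes pA with ∈ₛ-witness (embed (here refl) pA)
  ...   | B , B∈ , A≐B = subst₂ _≤_ (sym (count-accept pA)) (sym (count-remove B∈ (resp A≐B pA)))
                                  (s≤s (count-mono-∈ₛ resp nd embed′))
    where
    embed′ : ∀ {C} → C ∈ L → P C → C ∈ₛ remove L′ B∈
    embed′ C∈ pC with ∈ₛ-witness (embed (there C∈) pC)
    ... | D , D∈ , C≐D with ∈-remove B∈ D∈
    ...   | inj₁ refl = ⊥-elim (All.lookup A≉ C∈ (≐-trans A≐B (≐-sym C≐D)))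
    ...   | inj₂ D∈′ = ∈⇒∈ₛ D∈′ C≐D

  depth : List (Sub U) → Sub U → ℕ
  depth R B = count (B ⊊_) R

  depth-resp-≐ : ∀ R → B ≐ C → depth R B ≡ depth R C
  depth-resp-≐ R (B⊆C , C⊆B) = count-cong R λ _ → mk⇔ (⊆-⊊-trans C⊆B) (⊆-⊊-trans B⊆C)

  hits : List (Sub U) → U → ℕ
  hits R x = count (λ B → B x) R

  count-above : NoDup L → B ∈ L → (∀ {A} → A ∈ L → P A ⇔ B ⊆ A) → count P L ≡ suc (depth L B)
  count-above {L} {B} {P} nd B∈ P⇔ = begin
    count P L                   ≡⟨ count-cong L P⇔ ⟩
    count (B ⊆_) L              ≡⟨ count-⊆ L ⟩
    depth L B + count (_≐ B) L  ≡⟨ cong (depth L B +_) (count-≐-≡1 nd B∈) ⟩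
    depth L B + 1               ≡⟨ +-comm _ 1 ⟩
    suc (depth L B)             ∎
    where open ≡-Reasoning

  module Levels {R : List (Sub U)} (nd : NoDup R) (balls : All 𝓑 R) where

    ball-of : B ∈ R → 𝓑 B
    ball-of = All.lookup balls

    depth-child : 𝓑 C → B ∈ R → C ⊊ B → (∀ {A} → A ∈ R → C ⊊ A → ¬ A ⊊ B)
                → depth R C ≡ suc (depth R B)
    depth-child {C} {B} c B∈ C⊊B gap = count-above nd B∈ λ A∈ → mk⇔ (above A∈) (⊊-⊆-trans C⊊B)
      where
      above : A ∈ R → C ⊊ A → B ⊆ A
      above A∈ C⊊A with point c
      ... | y , Cy with comparable (ball-of A∈) (ball-of B∈) (proj₁ C⊊A y Cy) (proj₁ C⊊B y Cy)
      ...   | inj₂ B⊆A = B⊆A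
      ...   | inj₁ A⊆B with ⊆⇒⊊⊎≐ A⊆B
      ...     | inj₁ A⊊B = ⊥-elim (gap A∈ C⊊A A⊊B)
      ...     | inj₂ A≐B = proj₂ A≐B

    hits-smallest : B ∈ R → B x → (∀ {A} → A ∈ R → A x → ¬ A ⊊ B) → hits R x ≡ suc (depth R B)
    hits-smallest {B} {x} B∈ Bx smallest = count-above nd B∈ λ A∈ → mk⇔ (above A∈) (λ B⊆A → B⊆A x Bx)
      where
      above : A ∈ R → A x → B ⊆ A
      above A∈ Ax with comparable (ball-of A∈) (ball-of B∈) Ax Bx
      ... | inj₂ B⊆A = B⊆A
      ... | inj₁ A⊆B with ⊆⇒⊊⊎≐ A⊆B
      ...   | inj₁ A⊊B = ⊥-elim (smallest A∈ Ax A⊊B)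
      ...   | inj₂ A≐B = proj₂ A≐B

    depth-strict : C ∈ R → B ⊊ C → depth R C < depth R B
    depth-strict C∈ B⊊C = count-strict (λ _ C⊊A → ⊊-trans B⊊C C⊊A) C∈ B⊊C ⊊-irrefl

    parent : B ∈ R → n < depth R B → ∃[ C ] C ∈ R × B ⊊ C × n ≤ depth R C
    parent {B} {n} B∈ n<d with count-witness {xs = R} (≤-trans (s≤s z≤n) n<d)
    ... | A , A∈ , B⊊A with minimal⊊ A∈ B⊊A
    ...   | C , C∈ , B⊊C , C-min =
      C , C∈ , B⊊C , ≤-pred (subst (n <_) (depth-child (ball-of B∈) C∈ B⊊C C-min) n<d)

    maximal-at-level : B ∈ R → (n ≤ depth R B × AllL {U} (λ C → B ⊆ C → C ⊆ B) (select (λ A → n ≤ depth R A) R))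
                               ⇔ depth R B ≡ n
    maximal-at-level {B} {n} B∈ = mk⇔ to from
      where
      to : n ≤ depth R B × AllL {U} (λ C → B ⊆ C → C ⊆ B) (select (λ A → n ≤ depth R A) R) → depth R B ≡ n
      to (n≤d , max) with m≤n⇒m<n∨m≡n n≤d
      ... | inj₂ n≡d = sym n≡d
      ... | inj₁ n<d with parent B∈ n<d
      ...   | C , C∈ , (B⊆C , C⊈B) , n≤dC =
        ⊥-elim (C⊈B (All.lookup (AllL⇒All max) (∈-select⁺ C∈ n≤dC) B⊆C))
      from : depth R B ≡ n → n ≤ depth R B × AllL {U} (λ C → B ⊆ C → C ⊆ B) (select (λ A → n ≤ depth R A) R)
      from refl = ≤-refl , All⇒AllL (All.tabulate λ C∈′ B⊆C → below (∈-select⁻ R C∈′) B⊆C)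
        where
        below : C ∈ R × depth R B ≤ depth R C → B ⊆ C → C ⊆ B
        below {C} (C∈ , dB≤dC) B⊆C with lem {C ⊆ B}
        ... | yes C⊆B = C⊆B
        ... | no C⊈B = ⊥-elim (<⇒≱ (depth-strict C∈ (B⊆C , C⊈B)) dB≤dC)

    remaining-depth : ∀ n → remaining n R ≡ select (λ B → n ≤ depth R B) R
    Lev-depth : ∀ n → Lev n R ≡ select (λ B → depth R B ≡ n) R

    ∈ₛ-Lev⇒depth : B ∈ₛ Lev n R → depth R B ≡ n
    ∈ₛ-Lev⇒depth {B} {n} B∈ₛ with ∈ₛ-witness B∈ₛ
    ... | C , C∈ , B≐C = trans (depth-resp-≐ R B≐C) (proj₂ (∈-select⁻ R (subst (C ∈_) (Lev-depth n) C∈)))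

    ∈-Lev⁺ : B ∈ R → depth R B ≡ n → B ∈ Lev n R
    ∈-Lev⁺ {n = n} B∈ dB = subst (_ ∈_) (sym (Lev-depth n)) (∈-select⁺ B∈ dB)

    ∈-Lev⁻ : B ∈ Lev n R → B ∈ R × depth R B ≡ n
    ∈-Lev⁻ {n = n} B∈ = ∈-select⁻ R (subst (_ ∈_) (Lev-depth n) B∈)

    remaining-depth zero = trans (dedup-of-NoDup nd) (sym (select-all R λ _ → z≤n))
    remaining-depth (suc n) = begin
      remaining (suc n) R
        ≡⟨ sym (select-filter (remaining n R)) ⟩
      select (λ B → ¬ B ∈ₛ Lev n R) (remaining n R)
        ≡⟨ cong (select (λ B → ¬ B ∈ₛ Lev n R)) (remaining-depth n) ⟩
      select (λ B → ¬ B ∈ₛ Lev n R) (select (λ B → n ≤ depth R B) R)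
        ≡⟨ select-select R ⟩
      select (λ B → n ≤ depth R B × ¬ B ∈ₛ Lev n R) R
        ≡⟨ select-cong R (λ B∈ → mk⇔ (to B∈) from) ⟩
      select (λ B → suc n ≤ depth R B) R ∎
      where
      open ≡-Reasoning
      to : B ∈ R → n ≤ depth R B × ¬ B ∈ₛ Lev n R → suc n ≤ depth R B
      to B∈ (n≤d , B∉) with m≤n⇒m<n∨m≡n n≤d
      ... | inj₁ n<d = n<d
      ... | inj₂ n≡d = ⊥-elim (B∉ (∈⇒∈ₛ (∈-Lev⁺ B∈ (sym n≡d)) ≐-refl))
      from : suc n ≤ depth R B → n ≤ depth R B × ¬ B ∈ₛ Lev n R
      from n<d = <⇒≤ n<d , λ B∈ₛ → <⇒≢ n<d (sym (∈ₛ-Lev⇒depth B∈ₛ))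

    Lev-depth n = begin
      maximals (remaining n R)
        ≡⟨ cong maximals (remaining-depth n) ⟩
      maximals (select (λ B → n ≤ depth R B) R)
        ≡⟨ sym (select-filter _) ⟩
      select (λ B → AllL {U} (λ C → B ⊆ C → C ⊆ B) (select (λ A → n ≤ depth R A) R)) (select (λ B → n ≤ depth R B) R)
        ≡⟨ select-select R ⟩
      select (λ B → n ≤ depth R B × AllL {U} (λ C → B ⊆ C → C ⊆ B) (select (λ A → n ≤ depth R A) R)) R
        ≡⟨ select-cong R maximal-at-level ⟩
      select (λ B → depth R B ≡ n) R ∎
      where open ≡-Reasoning

    length-Lev : ∀ n → length (Lev n R) ≡ count (λ B → depth R B ≡ n) R
    length-Lev n = cong length (Lev-depth n)

    card-NoDup : card R ≡ length R
    card-NoDup = cong length (dedup-of-NoDup nd)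

    Ch⇒odd : Ch R x → parity (hits R x) ≡ 1ℙ
    Ch⇒odd {x} (n , B-any) with find (AnyL⇒Any B-any)
    ... | B , B∈Lev , Bx , no-child with ∈-Lev⁻ {n = 2 * n} B∈Lev
    ...   | B∈ , dB = trans (cong parity (trans (hits-smallest B∈ Bx smallest) (cong suc dB))) (parity-odd n)
      where
      smallest : ∀ {A} → A ∈ R → A x → ¬ A ⊊ B
      smallest A∈ Ax A⊊B with maximal⊊ {P = λ A → A x × A ⊊ B} A∈ (Ax , A⊊B)
      ... | C , C∈ , (Cx , C⊊B) , C-max =
        no-child (Any⇒AnyL (lose (∈-Lev⁺ {n = suc (2 * n)} C∈ (trans dC (cong suc dB))) (proj₁ C⊊B , Cx)))
        where
        dC : depth R C ≡ suc (depth R B)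
        dC = depth-child (ball-of C∈) B∈ C⊊B λ A∈ C⊊A A⊊B → C-max A∈ (proj₁ C⊊A x Cx , A⊊B) C⊊A

    odd⇒Ch : parity (hits R x) ≡ 1ℙ → Ch R x
    odd⇒Ch {x} odd with parity-1ℙ⇒odd _ odd
    ... | n , hits≡ with count-witness {xs = R} (subst (0 <_) (sym hits≡) (s≤s z≤n))
    ...   | A , A∈ , Ax with minimal⊊ {P = λ A → A x} A∈ Ax
    ...     | B , B∈ , Bx , B-min = n , Any⇒AnyL (lose (∈-Lev⁺ B∈ dB) (Bx , no-child))
      where
      dB : depth R B ≡ 2 * n
      dB = suc-injective (trans (sym (hits-smallest B∈ Bx B-min)) hits≡)
      no-child : ¬ AnyL {U} (λ C → C ⊆ B × C x) (Lev (suc (2 * n)) R)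
      no-child C-any with find (AnyL⇒Any C-any)
      ... | C , C∈Lev , C⊆B , Cx with ∈-Lev⁻ {n = suc (2 * n)} C∈Lev
      ...   | C∈ , dC with ⊆⇒⊊⊎≐ C⊆B
      ...     | inj₁ C⊊B = B-min C∈ Cx C⊊B
      ...     | inj₂ C≐B = 1+n≢n (trans (sym dC) (trans (depth-resp-≐ R C≐B) dB))

  _≺_ : List (Sub U) → List (Sub U) → Set
  R ≺ S = R ⊴ S × ¬ S ⊴ R

  ≺-of-card : ∀ {R S} → card R < card S → R ≺ S
  ≺-of-card lt = inj₂ (inj₁ lt) , λ
    { (inj₁ (eq , _))        → <⇒≢ lt (sym eq)
    ; (inj₂ (inj₁ gt))       → <-asym lt gt
    ; (inj₂ (inj₂ (eq , _))) → <⇒≢ lt (sym eq) }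

  ≺-of-Lev : ∀ {R S} k → card R ≡ card S → (∀ i → i < k → length (Lev i R) ≡ length (Lev i S))
           → length (Lev k S) < length (Lev k R) → R ≺ S
  ≺-of-Lev {R} {S} k eq below more = inj₂ (inj₂ (eq , k , below , more)) , λ
    { (inj₁ (_ , same))          → <⇒≢ more (same k)
    ; (inj₂ (inj₁ lt))           → <⇒≢ lt (sym eq)
    ; (inj₂ (inj₂ (_ , n , below′ , more′))) → first-difference n below′ more′ }
    where
    first-difference : ∀ n → (∀ i → i < n → length (Lev i S) ≡ length (Lev i R))
                     → length (Lev n S) > length (Lev n R) → ⊥
    first-difference n below′ more′ with <-cmp n k
    ... | tri< n<k _ _ = <⇒≢ more′ (below n n<k)
    ... | tri≈ _ refl _ = <-asym more more′
    ... | tri> _ _ k<n = <⇒≢ more (below′ k k<n)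

  SameShape : List (Sub U) → List (Sub U) → Set
  SameShape S S′ = card S ≡ card S′ × (∀ n → length (Lev n S) ≡ length (Lev n S′))

  ⊴-resp : ∀ {S S′ T T′} → SameShape S S′ → SameShape T T′ → S ⊴ T → S′ ⊴ T′
  ⊴-resp (cS , lS) (cT , lT) (inj₁ (c≡ , l≡)) =
    inj₁ (trans (sym cS) (trans c≡ cT) , λ n → trans (sym (lS n)) (trans (l≡ n) (lT n)))
  ⊴-resp (cS , lS) (cT , lT) (inj₂ (inj₁ c<)) = inj₂ (inj₁ (subst₂ _<_ cS cT c<))
  ⊴-resp (cS , lS) (cT , lT) (inj₂ (inj₂ (c≡ , n , l≡ , l>))) =
    inj₂ (inj₂ (trans (sym cS) (trans c≡ cT) , n , (λ i i<n → trans (sym (lS i)) (trans (l≡ i i<n) (lT i)))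
               , subst₂ _>_ (lS n) (lT n) l>))

  remaining-dedup : ∀ S n → remaining n (dedup S) ≡ remaining n S
  remaining-dedup S zero = dedup-of-NoDup (dedup-NoDup S)
  remaining-dedup S (suc n) = cong (λ L → filter (λ B → lem {¬ B ∈ₛ maximals L}) L) (remaining-dedup S n)

  Lev-dedup : ∀ S n → Lev n (dedup S) ≡ Lev n S
  Lev-dedup S n = cong maximals (remaining-dedup S n)

  shape-dedup : ∀ S → SameShape (dedup S) S
  shape-dedup S = cong length (remaining-dedup S 0) , cong length ∘ Lev-dedup S

  shape-refl : ∀ {S} → SameShape S S
  shape-refl = refl , λ _ → refl

  shape-sym : ∀ {S S′} → SameShape S S′ → SameShape S′ S
  shape-sym (c≡ , l≡) = sym c≡ , sym ∘ l≡

  Ch-dedup : ∀ S → Ch (dedup S) ≐ Ch S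
  Ch-dedup S = transport (Lev-dedup S) , transport (sym ∘ Lev-dedup S)
    where
    transport : ∀ {S S′} → (∀ n → Lev n S ≡ Lev n S′) → Ch S ⊆ Ch S′
    transport Lev≡ x (n , any) =
      n , subst₂ (λ L L′ → AnyL {U} (λ B → B x × ¬ AnyL {U} (λ C → C ⊆ B × C x) L′) L)
                 (Lev≡ (2 * n)) (Lev≡ (suc (2 * n))) any

  tops : List (Sub U) → ℕ
  tops T = count (λ B → depth T B ≡ 0) T

  record Optimal (X : Sub U) (P : List (Sub U)) : Set₁ where
    field
      nodup   : NoDup P
      balls   : All 𝓑 P
      ch      : Ch P ≐ X
      minimal : IsMinimal 𝓑 X P

  optimal-dedup : ∀ {X} S → All 𝓑 S → Ch S ≐ X → IsMinimal 𝓑 X S → Optimal X (dedup S)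
  optimal-dedup S balls ch min = record
    { nodup   = dedup-NoDup S
    ; balls   = All.tabulate (All.lookup balls ∘ dedup-⊆ S)
    ; ch      = ≐-trans (Ch-dedup S) ch
    ; minimal = λ R R-balls R-ch R⊴ →
        ⊴-resp (shape-sym (shape-dedup S)) shape-refl (min R R-balls R-ch (⊴-resp shape-refl (shape-dedup S) R⊴))
    }

  module _ {X P} (opt : Optimal X P) where
    open Optimal opt
    private module LP = Levels nodup balls

    unbeatable : ∀ {R} → NoDup R → All 𝓑 R → (∀ x → parity (hits R x) ≡ parity (hits P x)) → ¬ R ≺ P
    unbeatable {R} R-nodup R-balls same (R⊴P , P⋬R) = P⋬R (minimal R (All⇒AllL R-balls) (Ch-R⊆X , X⊆Ch-R) R⊴P)
      where
      module LR = Levels R-nodup R-balls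
      Ch-R⊆X : Ch R ⊆ X
      Ch-R⊆X x Ch-Rx = proj₁ ch x (LP.odd⇒Ch (trans (sym (same x)) (LR.Ch⇒odd Ch-Rx)))
      X⊆Ch-R : X ⊆ Ch R
      X⊆Ch-R x Xx = LR.odd⇒Ch (trans (same x) (LP.Ch⇒odd (proj₂ ch x Xx)))

    same-parity : ∀ {Q} → Optimal X Q → ∀ x → parity (hits P x) ≡ parity (hits Q x)
    same-parity q x = parity-≡
      (λ odd → LQ.Ch⇒odd (proj₂ (Optimal.ch q) x (proj₁ ch x (LP.odd⇒Ch odd))))
      (λ odd → LP.Ch⇒odd (proj₂ ch x (proj₁ (Optimal.ch q) x (LQ.odd⇒Ch odd))))
      where module LQ = Levels (Optimal.nodup q) (Optimal.balls q)

  module Inside {b : Sub U} (b-ball : 𝓑 b) where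

    inside outside : List (Sub U) → List (Sub U)
    inside = select (_⊆ b)
    outside = select (λ A → ¬ A ⊆ b)

    ∈-inside⁻ : ∀ L → B ∈ inside L → B ∈ L × B ⊆ b
    ∈-inside⁻ L = ∈-select⁻ L

    ∈-outside⁻ : ∀ L → B ∈ outside L → B ∈ L × ¬ B ⊆ b
    ∈-outside⁻ L = ∈-select⁻ L

    outside-⊋ : 𝓑 A → ¬ A ⊆ b → A x → b x → b ⊊ A
    outside-⊋ a A⊈b Ax bx with comparable a b-ball Ax bx
    ... | inj₁ A⊆b = ⊥-elim (A⊈b A⊆b)
    ... | inj₂ b⊆A = b⊆A , A⊈b

    count-⊊-outside : All 𝓑 L → 𝓑 B → B ⊆ b → count (B ⊊_) (outside L) ≡ count (b ⊊_) L
    count-⊊-outside {L} {B} balls B-ball B⊆b = trans (count-select L) (count-cong L λ A∈ → mk⇔ (to A∈) from)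
      where
      to : A ∈ L → ¬ A ⊆ b × B ⊊ A → b ⊊ A
      to A∈ (A⊈b , B⊊A) with point B-ball
      ... | x , Bx = outside-⊋ (All.lookup balls A∈) A⊈b (proj₁ B⊊A x Bx) (B⊆b x Bx)
      from : b ⊊ A → ¬ A ⊆ b × B ⊊ A
      from b⊊A = proj₂ b⊊A , ⊆-⊊-trans B⊆b b⊊A

    count-⊊-within : ¬ B ⊆ b → (∀ {A} → A ∈ L → A ⊆ b) → count (B ⊊_) L ≡ 0
    count-⊊-within {L = L} B⊈b ⊆b = count-zero L λ A∈ B⊊A → B⊈b (⊆-trans (proj₁ B⊊A) (⊆b A∈))

    hits-within : (∀ {A} → A ∈ L → A ⊆ b) → ¬ b x → hits L x ≡ 0
    hits-within {L = L} ⊆b ¬bx = count-zero L λ A∈ Ax → ¬bx (⊆b A∈ _ Ax)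

    hits-outside : All 𝓑 L → b x → hits (outside L) x ≡ count (b ⊊_) L
    hits-outside {L} {x} balls bx = trans (count-select L) (count-cong L λ A∈ → mk⇔ (to A∈) from)
      where
      to : A ∈ L → ¬ A ⊆ b × A x → b ⊊ A
      to A∈ (A⊈b , Ax) = outside-⊋ (All.lookup balls A∈) A⊈b Ax bx
      from : b ⊊ A → ¬ A ⊆ b × A x
      from b⊊A = proj₂ b⊊A , proj₁ b⊊A x bx

    hits-via-inside : All 𝓑 L → b x → hits L x ≡ hits (inside L) x + count (b ⊊_) L
    hits-via-inside {L} {x} balls bx =
      trans (count-split (_⊆ b) L) (cong (hits (inside L) x +_) (hits-outside balls bx))

    record Within (T : List (Sub U)) : Set₁ where
      field
        nodup  : NoDup T
        balls  : All 𝓑 T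
        within : ∀ {B} → B ∈ T → B ⊆ b

    Replaces : List (Sub U) → List (Sub U) → Set₁
    Replaces L T = Within T × (∀ x → b x → parity (hits T x) ≡ parity (hits (inside L) x))

    inside-within : NoDup L → All 𝓑 L → Within (inside L)
    inside-within {L} nd balls = record
      { nodup  = AllPairs-select nd
      ; balls  = All.tabulate (All.lookup balls ∘ proj₁ ∘ ∈-inside⁻ L)
      ; within = proj₂ ∘ ∈-inside⁻ L }

    module Replacement {L} (nd : NoDup L) (balls : All 𝓑 L) {T} (T-within : Within T) where
      open Within T-within renaming (nodup to T-nodup; balls to T-balls)

      k : ℕ
      k = count (b ⊊_) L

      replace-nodup : NoDup (outside L ++ T)
      replace-nodup = AllPairs.++⁺ (AllPairs-select nd) T-nodup
        (All.tabulate λ A∈ → All.tabulate λ B∈ A≐B → proj₂ (∈-outside⁻ L A∈) (⊆-trans (proj₁ A≐B) (within B∈)))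

      replace-balls : All 𝓑 (outside L ++ T)
      replace-balls = All.++⁺ (All.tabulate (All.lookup balls ∘ proj₁ ∘ ∈-outside⁻ L)) T-balls

      replace-parity : (∀ x → b x → parity (hits T x) ≡ parity (hits (inside L) x))
                     → ∀ x → parity (hits (outside L ++ T) x) ≡ parity (hits L x)
      replace-parity same x = begin
        parity (hits (outside L ++ T) x)                 ≡⟨ cong parity (count-++ (outside L) T) ⟩
        parity (hits (outside L) x + hits T x)           ≡⟨ ℙ.+-homo-+ (hits (outside L) x) _ ⟩
        parity (hits (outside L) x) +ℙ parity (hits T x) ≡⟨ cong (parity (hits (outside L) x) +ℙ_) inner ⟩
        parity (hits (outside L) x) +ℙ parity (hits (inside L) x) ≡⟨ ℙ.+-comm (parity (hits (outside L) x)) _ ⟩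
        parity (hits (inside L) x) +ℙ parity (hits (outside L) x) ≡⟨ sym (ℙ.+-homo-+ (hits (inside L) x) _) ⟩
        parity (hits (inside L) x + hits (outside L) x)  ≡⟨ cong parity (sym (count-split (_⊆ b) L)) ⟩
        parity (hits L x)                                ∎
        where
        open ≡-Reasoning
        inner : parity (hits T x) ≡ parity (hits (inside L) x)
        inner with lem {b x}
        ... | yes bx = same x bx
        ... | no ¬bx = cong parity (trans (hits-within within ¬bx) (sym (hits-within (proj₂ ∘ ∈-inside⁻ L) ¬bx)))

      length-replace : length (outside L ++ T) + length (inside L) ≡ length L + length T
      length-replace = begin
        length (outside L ++ T) + length (inside L)       ≡⟨ cong (_+ length (inside L)) (length-++ (outside L)) ⟩
        length (outside L) + length T + length (inside L) ≡⟨ +-assoc (length (outside L)) _ _ ⟩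
        length (outside L) + (length T + length (inside L)) ≡⟨ cong (length (outside L) +_) (+-comm (length T) _) ⟩
        length (outside L) + (length (inside L) + length T) ≡⟨ sym (+-assoc (length (outside L)) _ _) ⟩
        length (outside L) + length (inside L) + length T ≡⟨ cong (_+ length T) (+-comm (length (outside L)) _) ⟩
        length (inside L) + length (outside L) + length T ≡⟨ cong (_+ length T) (sym (length-split (_⊆ b) L)) ⟩
        length L + length T                               ∎
        where open ≡-Reasoning

      depth-inside : B ∈ inside L → depth L B ≡ k + depth (inside L) B
      depth-inside {B} B∈ with ∈-inside⁻ L B∈
      ... | B∈L , B⊆b = trans (count-split (_⊆ b) L)
        (trans (+-comm (depth (inside L) B) _) (cong (_+ depth (inside L) B) (count-⊊-outside balls (All.lookup balls B∈L) B⊆b)))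

      depth-replace-inner : B ∈ T → depth (outside L ++ T) B ≡ k + depth T B
      depth-replace-inner B∈ = trans (count-++ (outside L) T)
        (cong (_+ depth T _) (count-⊊-outside balls (All.lookup T-balls B∈) (within B∈)))

      depth-replace-outer : B ∈ outside L → depth (outside L ++ T) B ≡ depth L B
      depth-replace-outer {B} B∈ = begin
        depth (outside L ++ T) B                     ≡⟨ count-++ (outside L) T ⟩
        depth (outside L) B + depth T B              ≡⟨ cong (depth (outside L) B +_) (count-⊊-within B⊈b within) ⟩
        depth (outside L) B + 0                      ≡⟨ +-comm _ 0 ⟩
        0 + depth (outside L) B                      ≡⟨ cong (_+ depth (outside L) B) (sym (count-⊊-within B⊈b (proj₂ ∘ ∈-inside⁻ L))) ⟩
        depth (inside L) B + depth (outside L) B     ≡⟨ sym (count-split (_⊆ b) L) ⟩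
        depth L B                                    ∎
        where
        open ≡-Reasoning
        B⊈b = proj₂ (∈-outside⁻ L B∈)

      module LR = Levels replace-nodup replace-balls
      module LL = Levels nd balls

      length-Lev-replace : ∀ n → length (Lev n (outside L ++ T))
                         ≡ count (λ B → depth L B ≡ n) (outside L) + count (λ B → k + depth T B ≡ n) T
      length-Lev-replace n = trans (LR.length-Lev n) (trans (count-++ (outside L) T)
        (cong₂ _+_ (count-cong (outside L) (≡-⇔ ∘ depth-replace-outer)) (count-cong T (≡-⇔ ∘ depth-replace-inner))))

      length-Lev-split : ∀ n → length (Lev n L)
                       ≡ count (λ B → depth L B ≡ n) (outside L) + count (λ B → k + depth (inside L) B ≡ n) (inside L)
      length-Lev-split n = trans (LL.length-Lev n) (trans (count-split (_⊆ b) L)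
        (trans (+-comm (count (λ B → depth L B ≡ n) (inside L)) _)
               (cong (count (λ B → depth L B ≡ n) (outside L) +_) (count-cong (inside L) (≡-⇔ ∘ depth-inside)))))

    toggle : NoDup L → All 𝓑 L
           → ∃[ T ] Within T × length T ≤ suc (length (inside L))
                    × (∀ x → b x → parity (hits T x) ≡ parity (suc (hits (inside L) x)))
    toggle {L} nd balls with lem {b ∈ₛ L}
    ... | no b∉L = b ∷ inside L , with-b , ≤-refl , λ x bx → cong parity (count-accept bx)
      where
      with-b : Within (b ∷ inside L)
      with-b = record
        { nodup  = All.tabulate (λ B∈ b≐B → b∉L (∈⇒∈ₛ (proj₁ (∈-inside⁻ L B∈)) b≐B)) ∷ AllPairs-select nd
        ; balls  = b-ball ∷ Within.balls (inside-within nd balls)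
        ; within = λ { (here refl) → ⊆-refl ; (there B∈) → proj₂ (∈-inside⁻ L B∈) } }
    ... | yes b∈ₛL with ∈ₛ-witness b∈ₛL
    ...   | b′ , b′∈ , b≐b′ =
      strictly , without-b , m≤n⇒m≤1+n (count-mono L λ _ → proj₁) , λ x bx → sym (cong (parity ∘ suc) (hits-inside x bx))
      where
      strictly : List (Sub U)
      strictly = select (_⊊ b) L
      without-b : Within strictly
      without-b = record
        { nodup  = AllPairs-select nd
        ; balls  = All.tabulate (All.lookup balls ∘ proj₁ ∘ ∈-select⁻ L)
        ; within = proj₁ ∘ proj₂ ∘ ∈-select⁻ L }
      split : ∀ {x} → b x → A ⊆ b × A x → (A ⊊ b × A x) ⊎ A ≐ b
      split bx (A⊆b , Ax) with ⊆⇒⊊⊎≐ A⊆b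
      ... | inj₁ A⊊b = inj₁ (A⊊b , Ax)
      ... | inj₂ A≐b = inj₂ A≐b
      join : ∀ {x} → b x → (A ⊊ b × A x) ⊎ A ≐ b → A ⊆ b × A x
      join bx (inj₁ (A⊊b , Ax)) = proj₁ A⊊b , Ax
      join bx (inj₂ (A⊆b , b⊆A)) = A⊆b , b⊆A _ bx
      hits-inside : ∀ x → b x → hits (inside L) x ≡ suc (hits strictly x)
      hits-inside x bx = begin
        hits (inside L) x                                        ≡⟨ count-select L ⟩
        count (λ A → A ⊆ b × A x) L                              ≡⟨ count-cong L (λ _ → mk⇔ (split bx) (join bx)) ⟩
        count (λ A → (A ⊊ b × A x) ⊎ A ≐ b) L                    ≡⟨ count-⊎ L (λ _ A⊊b A≐b → proj₂ (proj₁ A⊊b) (proj₂ A≐b)) ⟩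
        count (λ A → A ⊊ b × A x) L + count (_≐ b) L             ≡⟨ cong₂ _+_ (sym (count-select L)) b-once ⟩
        hits strictly x + 1                                      ≡⟨ +-comm _ 1 ⟩
        suc (hits strictly x)                                    ∎
        where
        open ≡-Reasoning
        b-once : count (_≐ b) L ≡ 1
        b-once = trans (count-cong L λ _ → mk⇔ (flip ≐-trans b≐b′) (flip ≐-trans (≐-sym b≐b′))) (count-≐-≡1 nd b′∈)

    module _ {X L} (opt : Optimal X L) where
      open Optimal opt

      replacement-not-shorter : ∀ {T} → Replaces L T → length (inside L) ≤ length T
      replacement-not-shorter {T} (T-within , same) = ≮⇒≥ λ shorter →
        unbeatable opt replace-nodup replace-balls (replace-parity same) (≺-of-card (card< shorter))
        where
        open Replacement nodup balls T-within
        card< : length T < length (inside L) → card (outside L ++ T) < card L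
        card< shorter = subst₂ _<_ (sym LR.card-NoDup) (sym LL.card-NoDup)
          (+-cancelʳ-< (length (inside L)) _ _
            (subst (_< length L + length (inside L)) (sym length-replace) (+-monoʳ-< (length L) shorter)))

      replacement-tops : ∀ {T} → Replaces L T → length T ≡ length (inside L) → tops T ≤ tops (inside L)
      replacement-tops {T} (T-within , same) same-length = ≮⇒≥ λ more-tops →
        unbeatable opt replace-nodup replace-balls (replace-parity same) (≺-of-Lev k card≡ below (at more-tops))
        where
        open Replacement nodup balls T-within
        card≡ : card (outside L ++ T) ≡ card L
        card≡ = trans LR.card-NoDup (trans
          (+-cancelʳ-≡ (length (inside L)) _ _ (trans length-replace (cong (length L +_) same-length)))
          (sym LL.card-NoDup))
        below : ∀ i → i < k → length (Lev i (outside L ++ T)) ≡ length (Lev i L)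
        below i i<k = trans (length-Lev-replace i) (trans
          (cong (count (λ B → depth L B ≡ i) (outside L) +_)
            (trans (count-shifted-below (depth T) T i<k) (sym (count-shifted-below (depth (inside L)) (inside L) i<k))))
          (sym (length-Lev-split i)))
        at : tops (inside L) < tops T → length (Lev k L) < length (Lev k (outside L ++ T))
        at more-tops = begin-strict
          length (Lev k L)                       ≡⟨ length-Lev-split k ⟩
          o + count (λ B → k + depth (inside L) B ≡ k) (inside L) ≡⟨ cong (o +_) (count-shifted-base (depth (inside L)) (inside L)) ⟩
          o + tops (inside L)                    <⟨ +-monoʳ-< o more-tops ⟩
          o + tops T                             ≡⟨ cong (o +_) (sym (count-shifted-base (depth T) T)) ⟩
          o + count (λ B → k + depth T B ≡ k) T  ≡⟨ sym (length-Lev-replace k) ⟩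
          length (Lev k (outside L ++ T))        ∎
          where
          open ≤-Reasoning
          o = count (λ B → depth L B ≡ k) (outside L)

  unique-top : tops L ≤ 1 → A ∈ L → ∃[ D ] D ∈ L × (∀ {B} → B ∈ L → B ⊆ D)
  unique-top {L} one-top A∈ with maximal⊊ {P = λ _ → ⊤} A∈ tt
  ... | D , D∈ , _ , D-max = D , D∈ , below
    where
    top : ∀ {M} → (∀ {B} → B ∈ L → ¬ M ⊊ B) → depth L M ≡ 0
    top M-max = count-zero L M-max
    below : ∀ {B} → B ∈ L → B ⊆ D
    below B∈ with maximal⊊ {P = _ ⊆_} B∈ ⊆-refl
    ... | M , M∈ , B⊆M , M-max with lem {M ≐ D}
    ...   | yes M≐D = ⊆-trans B⊆M (proj₁ M≐D)
    ...   | no M≉D = ⊥-elim (<⇒≱ (count-≥2 M∈ D∈ (λ { refl → M≉D ≐-refl }) (top M-global) (top (λ C∈ → D-max C∈ tt))) one-top)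
      where
      M-global : ∀ {C} → C ∈ L → ¬ M ⊊ C
      M-global C∈ M⊊C = M-max C∈ (⊆-trans B⊆M (proj₁ M⊊C)) M⊊C

  count-⊊-gap : 𝓑 A → 𝓑 C → All 𝓑 L → A ⊊ C → (∀ {B} → B ∈ L → A ⊊ B → ¬ B ⊊ C)
              → count (A ⊊_) L ≡ count (C ⊆_) L
  count-⊊-gap {A} {C} {L} a c balls A⊊C gap = count-cong L λ B∈ → mk⇔ (to B∈) (⊊-⊆-trans A⊊C)
    where
    to : B ∈ L → A ⊊ B → C ⊆ B
    to B∈ A⊊B with point a
    ... | x , Ax with comparable (All.lookup balls B∈) c (proj₁ A⊊B x Ax) (proj₁ A⊊C x Ax)
    ...   | inj₂ C⊆B = C⊆B
    ...   | inj₁ B⊆C with ⊆⇒⊊⊎≐ B⊆C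
    ...     | inj₁ B⊊C = ⊥-elim (gap B∈ A⊊B B⊊C)
    ...     | inj₂ B≐C = proj₂ B≐C

  module MaximalDifference {X P Q} (p : Optimal X P) (q : Optimal X Q) {c} (c∈Q : c ∈ Q) (c∉P : ¬ c ∈ₛ P)
                           (P-above : ∀ {A} → A ∈ P → c ⊊ A → A ∈ₛ Q)
                           (Q-above : ∀ {A} → A ∈ Q → c ⊊ A → A ∈ₛ P) where
    private
      module p = Optimal p
      module q = Optimal q

    c-ball : 𝓑 c
    c-ball = All.lookup q.balls c∈Q

    open Inside c-ball

    k : ℕ
    k = count (c ⊊_) Q

    above-c : count (c ⊊_) P ≡ k
    above-c = ≤-antisym (count-mono-∈ₛ resp p.nodup P-above) (count-mono-∈ₛ resp q.nodup Q-above)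
      where
      resp : ∀ {A B} → A ≐ B → c ⊊ A → c ⊊ B
      resp (A⊆B , _) c⊊A = ⊊-⊆-trans c⊊A A⊆B

    inside-parity : ∀ x → c x → parity (hits (inside P) x) ≡ parity (hits (inside Q) x)
    inside-parity x cx = parity-cancelʳ (hits (inside P) x) (hits (inside Q) x) k (begin
      parity (hits (inside P) x + k) ≡⟨ cong parity (sym (trans (hits-via-inside p.balls cx) (cong (hits (inside P) x +_) above-c))) ⟩
      parity (hits P x)              ≡⟨ same-parity p q x ⟩
      parity (hits Q x)              ≡⟨ cong parity (hits-via-inside q.balls cx) ⟩
      parity (hits (inside Q) x + k) ∎)
      where open ≡-Reasoning

    inside-lengths : length (inside P) ≡ length (inside Q)
    inside-lengths = ≤-antisym
      (replacement-not-shorter p (inside-within q.nodup q.balls , λ x cx → sym (inside-parity x cx)))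
      (replacement-not-shorter q (inside-within p.nodup p.balls , inside-parity))

    c∈inside-Q : c ∈ inside Q
    c∈inside-Q = ∈-select⁺ c∈Q ⊆-refl

    tops-inside-Q : tops (inside Q) ≤ 1
    tops-inside-Q = ≤-trans (count-mono (inside Q) is-c) (count-≐-≤1 (Within.nodup (inside-within q.nodup q.balls)))
      where
      is-c : ∀ {B} → B ∈ inside Q → depth (inside Q) B ≡ 0 → B ≐ c
      is-c B∈ top with ⊆⇒⊊⊎≐ (proj₂ (∈-inside⁻ Q B∈))
      ... | inj₁ B⊊c = ⊥-elim (<⇒≢ (count-pos c∈inside-Q B⊊c) (sym top))
      ... | inj₂ B≐c = B≐c

    tops-inside-P : tops (inside P) ≤ 1
    tops-inside-P = ≤-trans (replacement-tops q (inside-within p.nodup p.balls , inside-parity) inside-lengths) tops-inside-Q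

    inside-P-⊊ : B ∈ inside P → B ⊊ c
    inside-P-⊊ B∈ with ∈-inside⁻ P B∈
    ... | B∈P , B⊆c = B⊆c , λ c⊆B → c∉P (∈⇒∈ₛ B∈P (c⊆B , B⊆c))

    module Shortening {D} (below-D : ∀ {B} → B ∈ inside P → B ⊆ D)
                      {e} (e∈ : e ∈ P ++ Q) (D⊆e : D ⊆ e) (e⊊c : e ⊊ c)
                      (e-max : ∀ {A} → A ∈ P ++ Q → D ⊆ A × A ⊊ c → ¬ e ⊊ A)
                      {x₀} (cx₀ : c x₀) (¬ex₀ : ¬ e x₀) where

      e-ball : 𝓑 e
      e-ball = All.lookup (All.++⁺ p.balls q.balls) e∈

      module E = Inside e-ball

      gap : ∀ {A} → A ∈ P ++ Q → e ⊊ A → ¬ A ⊊ c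
      gap A∈ e⊊A A⊊c = e-max A∈ (⊆-trans D⊆e (proj₁ e⊊A) , A⊊c) e⊊A

      above-e-P : count (e ⊊_) P ≡ k
      above-e-P = begin
        count (e ⊊_) P                  ≡⟨ count-⊊-gap e-ball c-ball p.balls e⊊c (gap ∘ ∈-++⁺ˡ) ⟩
        count (c ⊆_) P                  ≡⟨ count-⊆ P ⟩
        count (c ⊊_) P + count (_≐ c) P ≡⟨ cong₂ _+_ above-c (count-≐-≡0 c∉P) ⟩
        k + 0                           ≡⟨ +-identityʳ k ⟩
        k                               ∎
        where open ≡-Reasoning

      above-e-Q : count (e ⊊_) Q ≡ suc k
      above-e-Q = begin
        count (e ⊊_) Q      ≡⟨ count-⊊-gap e-ball c-ball q.balls e⊊c (gap ∘ ∈-++⁺ʳ P) ⟩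
        count (c ⊆_) Q      ≡⟨ count-⊆ Q ⟩
        k + count (_≐ c) Q  ≡⟨ cong (k +_) (count-≐-≡1 q.nodup c∈Q) ⟩
        k + 1               ≡⟨ +-comm k 1 ⟩
        suc k               ∎
        where open ≡-Reasoning

      inside-e-parity : ∀ x → e x → parity (hits (E.inside P) x) ≡ parity (suc (hits (E.inside Q) x))
      inside-e-parity x ex = parity-cancelʳ (hits (E.inside P) x) (suc (hits (E.inside Q) x)) k (begin
        parity (hits (E.inside P) x + k)      ≡⟨ cong parity (sym (trans (E.hits-via-inside p.balls ex) (cong (hits (E.inside P) x +_) above-e-P))) ⟩
        parity (hits P x)                     ≡⟨ same-parity p q x ⟩
        parity (hits Q x)                     ≡⟨ cong parity (trans (E.hits-via-inside q.balls ex) (cong (hits (E.inside Q) x +_) above-e-Q)) ⟩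
        parity (hits (E.inside Q) x + suc k)  ≡⟨ cong parity (+-suc (hits (E.inside Q) x) k) ⟩
        parity (suc (hits (E.inside Q) x) + k) ∎)
        where open ≡-Reasoning

      hits-inside-Q-x₀ : 2 ≤ hits (inside Q) x₀
      hits-inside-Q-x₀ = parity-0ℙ⇒≥2 (hits (inside Q) x₀) (count-pos c∈inside-Q cx₀)
        (trans (sym (inside-parity x₀ cx₀)) (cong parity (count-zero (inside P) λ B∈ Bx₀ → ¬ex₀ (⊆-trans (below-D B∈) D⊆e x₀ Bx₀))))

      inside-e-lengths : 2 + length (E.inside Q) ≤ length (E.inside P)
      inside-e-lengths = begin
        2 + length (E.inside Q)                                         ≤⟨ +-monoˡ-≤ (length (E.inside Q)) (≤-trans hits-inside-Q-x₀ (count-mono (inside Q) outside-e)) ⟩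
        count (λ A → ¬ A ⊆ e) (inside Q) + length (E.inside Q)          ≡⟨ +-comm (count (λ A → ¬ A ⊆ e) (inside Q)) (length (E.inside Q)) ⟩
        length (E.inside Q) + count (λ A → ¬ A ⊆ e) (inside Q)          ≡⟨ cong (_+ count (λ A → ¬ A ⊆ e) (inside Q)) (sym (trans (count-select Q) (count-cong Q λ _ → mk⇔ proj₂ λ A⊆e → ⊆-trans A⊆e (proj₁ e⊊c) , A⊆e))) ⟩
        count (_⊆ e) (inside Q) + count (λ A → ¬ A ⊆ e) (inside Q)      ≡⟨ sym (length-split (_⊆ e) (inside Q)) ⟩
        length (inside Q)                                               ≡⟨ sym inside-lengths ⟩
        length (inside P)                                               ≡⟨ count-cong P (λ A∈ → mk⇔ (λ A⊆c → ⊆-trans (below-D (∈-select⁺ A∈ A⊆c)) D⊆e) (λ A⊆e → ⊆-trans A⊆e (proj₁ e⊊c))) ⟩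
        length (E.inside P)                                             ∎
        where
        open ≤-Reasoning
        outside-e : ∀ {A} → A ∈ inside Q → A x₀ → ¬ A ⊆ e
        outside-e _ Ax₀ A⊆e = ¬ex₀ (A⊆e x₀ Ax₀)

      impossible : ⊥
      impossible with E.toggle q.nodup q.balls
      ... | T , T-within , T-short , T-parity =
        <⇒≱ (≤-trans (s≤s T-short) inside-e-lengths)
            (E.replacement-not-shorter p (T-within , λ x ex → trans (T-parity x ex) (sym (inside-e-parity x ex))))

    inside-P-element : ∃[ A ] A ∈ inside P
    inside-P-element = element (subst (0 <_) (sym inside-lengths) (count-pos {P = _⊆ c} c∈Q ⊆-refl))

    top-inside-P : ∃[ D ] D ∈ inside P × (∀ {B} → B ∈ inside P → B ⊆ D)
    top-inside-P = unique-top tops-inside-P (proj₂ inside-P-element)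

    impossible : ⊥
    impossible =
      let D , D∈ , below-D = top-inside-P
          e , e∈ , (D⊆e , e⊊c) , e-max = maximal⊊ {L = P ++ Q} {P = λ A → D ⊆ A × A ⊊ c}
                                           (∈-++⁺ˡ (proj₁ (∈-inside⁻ P D∈))) (⊆-refl , inside-P-⊊ D∈)
          x₀ , cx₀ , ¬ex₀ = ⊊-witness e⊊c
      in Shortening.impossible below-D e∈ D⊆e e⊊c e-max cx₀ ¬ex₀

  Difference : List (Sub U) → List (Sub U) → Sub U → Set
  Difference P Q A = (A ∈ₛ P × ¬ A ∈ₛ Q) ⊎ (A ∈ₛ Q × ¬ A ∈ₛ P)

  optimal-⊆ₛ : ∀ {X P Q} → Optimal X P → Optimal X Q → ∀ {B} → B ∈ P → B ∈ₛ Q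
  optimal-⊆ₛ {X} {P} {Q} p q {B} B∈ with lem {B ∈ₛ Q}
  ... | yes B∈ₛQ = B∈ₛQ
  ... | no B∉Q with maximal⊊ {L = P ++ Q} {P = Difference P Q} (∈-++⁺ˡ B∈) (inj₁ (∈⇒∈ₛ B∈ ≐-refl , B∉Q))
  ...   | c , c∈ , c-differs , c-max = ⊥-elim (from-difference c-differs)
    where
    P-above : ∀ {A} → A ∈ P → c ⊊ A → A ∈ₛ Q
    P-above {A} A∈ c⊊A with lem {A ∈ₛ Q}
    ... | yes A∈ₛQ = A∈ₛQ
    ... | no A∉Q = ⊥-elim (c-max (∈-++⁺ˡ A∈) (inj₁ (∈⇒∈ₛ A∈ ≐-refl , A∉Q)) c⊊A)
    Q-above : ∀ {A} → A ∈ Q → c ⊊ A → A ∈ₛ P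
    Q-above {A} A∈ c⊊A with lem {A ∈ₛ P}
    ... | yes A∈ₛP = A∈ₛP
    ... | no A∉P = ⊥-elim (c-max (∈-++⁺ʳ P A∈) (inj₂ (∈⇒∈ₛ A∈ ≐-refl , A∉P)) c⊊A)
    from-difference : Difference P Q c → ⊥
    from-difference (inj₁ (_ , c∉Q)) with ∈-++⁻ P c∈
    ... | inj₁ c∈P = MaximalDifference.impossible q p c∈P c∉Q Q-above P-above
    ... | inj₂ c∈Q = c∉Q (∈⇒∈ₛ c∈Q ≐-refl)
    from-difference (inj₂ (_ , c∉P)) with ∈-++⁻ P c∈
    ... | inj₁ c∈P = c∉P (∈⇒∈ₛ c∈P ≐-refl)
    ... | inj₂ c∈Q = MaximalDifference.impossible p q c∈Q c∉P P-above Q-above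

  ∈ₛ-dedup⁻ : ∀ S → B ∈ₛ dedup S → B ∈ₛ S
  ∈ₛ-dedup⁻ S B∈ₛ = let C , C∈ , B≐C = ∈ₛ-witness B∈ₛ in ∈⇒∈ₛ (dedup-⊆ S C∈) B≐C

  ≈ₛ-of-dedup : ∀ S T → (∀ {B} → B ∈ dedup S → B ∈ₛ dedup T) → (∀ {B} → B ∈ dedup T → B ∈ₛ dedup S) → S ≈ₛ T
  ≈ₛ-of-dedup S T S⊆T T⊆S = All⇒AllL (All.tabulate (via S T S⊆T)) , All⇒AllL (All.tabulate (via T S T⊆S))
    where
    via : ∀ S T → (∀ {B} → B ∈ dedup S → B ∈ₛ dedup T) → ∀ {B} → B ∈ S → B ∈ₛ T
    via S T S⊆T B∈ = let C , C∈ , B≐C = ∈ₛ-witness (dedup-∈ₛ S B∈) in ∈ₛ-dedup⁻ T (∈ₛ-resp-≐ B≐C (S⊆T C∈))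

theorem3p1 : (lem : ExcludedMiddle 0ℓ) → (U : Set) → (𝓑 : Sub U → Set) → IsDirected 𝓑
           → Σ (Sub U) (λ B → 𝓑 B × (∀ x → B x))
           → (X : Sub U) → Constructible 𝓑 X
           → (S T : List (Sub U)) → AllL {U} 𝓑 S → AllL {U} 𝓑 T
           → Classical.Ch {U} lem S ≐ X → Classical.Ch {U} lem T ≐ X
           → Classical.IsMinimal {U} lem 𝓑 X S → Classical.IsMinimal {U} lem 𝓑 X T
           → S ≈ₛ T
theorem3p1 lem U 𝓑 directed _ X _ S T S-balls T-balls S-ch T-ch S-min T-min =
  ≈ₛ-of-dedup S T (optimal-⊆ₛ s t) (optimal-⊆ₛ t s)
  where
  open Forest lem 𝓑 directed
  open Subsets
  s : Optimal X (Classical.dedup lem S)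
  s = optimal-dedup S (AllL⇒All S-balls) S-ch S-min
  t : Optimal X (Classical.dedup lem T)
  t = optimal-dedup T (AllL⇒All T-balls) T-ch T-min
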